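{- Let $M$ be a model of $T^+$ and let $x,y,z$ be distinct elements of $M$. Then $x\uparrow\{y,z\}$ holds iff there is $w\in M$, $w\ne x$, with $\{x,w\}<\{y,z\}$; and $x\downarrow\{y,z\}$ holds iff there is $w\in M$, $w\ne x$, with $\{x,w\}>\{y,z\}$.
   Context: For a set $M$, $[M]^2$ is the set of 2-element subsets of $M$. A switchboard is a set $M$ with a strict partial order $<$ on $[M]^2$ such that for distinct $x,y,z\in M$, $\{x,y\}$ and $\{x,z\}$ are incomparable. A labeled switchboard is $(M,<,\uparrow,\downarrow)$ where $(M,<)$ is a switchboard, $\uparrow,\downarrow$ are binary relations between $M$ and $[M]^2$, and: (Trichotomy) for every $a\in M$, $\{b,c\}\in[M]^2$ exactly one of $a\uparrow\{b,c\}$, $a\in\{b,c\}$, $a\downarrow\{b,c\}$ holds; (Upward) $a\uparrow\{b,c\}<\{b',c'\}$ implies $a\uparrow\{b',c'\}$; (Downward) $a\downarrow\{b,c\}>\{b',c'\}$ implies $a\downarrow\{b',c'\}$. These are structures in the relational language $L^+$ (4-ary $<$, 3-ary $\uparrow,\downarrow$). The class of finite labeled switchboards is a Fraïssé class; $T^+$ denotes the complete theory of its Fraïssé limit (equivalently, the model completion of the theory of labeled switchboards; it has quantifier elimination). -}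

module Defs where

open import Data.Nat using (ℕ; suc)
open import Data.Fin using (Fin; zero; suc)
open import Data.Product using (Σ; _×_; _,_)
open import Data.Sum using (_⊎_)
open import Data.Empty using (⊥)
open import Relation.Nullary using (¬_)
open import Relation.Binary.PropositionalEquality using (_≡_; _≢_)
open import Function.Bundles using (_⇔_)

-- A 2-element subset {a,b} of the carrier is
-- represented by any ordered pair (a , b) with a ≢ b; all relations are
-- required to be invariant under swapping the two elements of a pair, so
-- they are really relations on [M]^2.
--   Lt a b c d   means  {a,b} < {c,d}
--   Up a b c     means  a ↑ {b,c}
--   Down a b c   means  a ↓ {b,c}
record LabeledSwitchboard (Carrier : Set) : Set₁ where
  field
    Lt      : Carrier → Carrier → Carrier → Carrier → Set
    Up      : Carrier → Carrier → Carrier → Set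
    Down    : Carrier → Carrier → Carrier → Set

    Lt-proper₁ : ∀ {a b c d} → Lt a b c d → a ≢ b
    Lt-proper₂ : ∀ {a b c d} → Lt a b c d → c ≢ d
    Up-proper   : ∀ {a b c} → Up a b c → b ≢ c
    Down-proper : ∀ {a b c} → Down a b c → b ≢ c
    Lt-sym₁   : ∀ {a b c d} → Lt a b c d → Lt b a c d
    Lt-sym₂   : ∀ {a b c d} → Lt a b c d → Lt a b d c
    Up-sym    : ∀ {a b c} → Up a b c → Up a c b
    Down-sym  : ∀ {a b c} → Down a b c → Down a c b

    Lt-irrefl : ∀ {a b} → ¬ Lt a b a b
    Lt-trans  : ∀ {a b c d e f} → Lt a b c d → Lt c d e f → Lt a b e f

    switch : ∀ {x y z} → x ≢ y → x ≢ z → y ≢ z → ¬ Lt x y x z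

    trichotomy : ∀ a {b c} → b ≢ c → (Up a b c ⊎ (a ≡ b ⊎ a ≡ c)) ⊎ Down a b c
    Up-notin₁   : ∀ {a b c} → Up a b c → a ≢ b
    Up-notin₂   : ∀ {a b c} → Up a b c → a ≢ c
    Down-notin₁ : ∀ {a b c} → Down a b c → a ≢ b
    Down-notin₂ : ∀ {a b c} → Down a b c → a ≢ c
    Up-Down-excl : ∀ {a b c} → Up a b c → ¬ Down a b c

    upward   : ∀ {a b c b' c'} → Up a b c → Lt b c b' c' → Up a b' c'
    downward : ∀ {a b c b' c'} → Down a b c → Lt b' c' b c → Down a b' c'

open LabeledSwitchboard public

record Compatible {D A C : Set} (B : LabeledSwitchboard A) (M : LabeledSwitchboard C)
                  (p : D → A) (q : D → C) : Set where
  field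
    eq   : ∀ i j → (p i ≡ p j) ⇔ (q i ≡ q j)
    lt   : ∀ i j k l → Lt B (p i) (p j) (p k) (p l) ⇔ Lt M (q i) (q j) (q k) (q l)
    up   : ∀ i j k → Up B (p i) (p j) (p k) ⇔ Up M (q i) (q j) (q k)
    down : ∀ i j k → Down B (p i) (p j) (p k) ⇔ Down M (q i) (q j) (q k)

IsEmbedding : {A C : Set} (B : LabeledSwitchboard A) (M : LabeledSwitchboard C) → (A → C) → Set
IsEmbedding B M f = Compatible B M (λ x → x) f

extend : {X : Set} {n : ℕ} → X → (Fin n → X) → Fin (suc n) → X
extend m g zero    = m
extend m g (suc i) = g i

-- Models of T⁺: labeled switchboards satisfying the one-point extension
-- axioms of the Fraïssé limit of finite labeled switchboards: for every
-- finite labeled switchboard B on Fin (suc n) and every embedding g into M of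
-- the substructure of B on {1,…,n} (i.e. g is compatible with suc), there is
-- m in M such that g extended by 0 ↦ m is an embedding of B into M.
ExtensionProperty : {C : Set} → LabeledSwitchboard C → Set₁
ExtensionProperty {C} M =
  ∀ (n : ℕ) (B : LabeledSwitchboard (Fin (suc n))) (g : Fin n → C) →
  Compatible B M suc g →
  Σ C (λ m → IsEmbedding B M (extend m g))

record ModelOfTplus (C : Set) : Set₁ where
  field
    structure : LabeledSwitchboard C
    extension : ExtensionProperty structure

-- The implications from right to left hold in every labeled switchboard: if
-- {x,w} < {y,z} and x ↓ {y,z}, downward closure would give x ↓ {x,w}.  Adjoin to the substructure on {x,y,z}
-- a new point w such that {w,x} lies below exactly the pairs that x is above,
-- w is above every old pair, and every old point is below every pair
-- containing w.  This is again a finite labeled switchboard, so the extension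
-- property realises w in M.  The statement for ↓ is the statement for ↑ in the
-- dual structure, which reverses < and exchanges ↑ with ↓.
module Submission where

open import Defs
open import Data.Product using (Σ; _×_; _,_)
open import Relation.Binary.PropositionalEquality using (_≢_)
open import Function.Bundles using (_⇔_)

open import Data.Nat using (ℕ; suc)
open import Data.Fin using (Fin; zero; suc; _≟_)
open import Data.Fin.Properties using (suc-injective; 0≢1+n)
open import Data.Sum using (_⊎_; inj₁; inj₂; [_,_]′; map; map₁; map₂)
open import Data.Empty using (⊥; ⊥-elim)
open import Relation.Nullary using (yes; no)
open import Relation.Binary.PropositionalEquality using (_≡_; refl; sym; cong)
open import Function using (id; _∘_)
open import Function.Bundles using (mk⇔; Equivalence)
open import Function.Definitions using (Injective)
import Function.Properties.Equivalence as ⇔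

private
  variable
    A C D : Set

dual : LabeledSwitchboard A → LabeledSwitchboard A
dual M = record
  { Lt           = λ a b c d → Lt M c d a b
  ; Up           = Down M
  ; Down         = Up M
  ; Lt-proper₁   = Lt-proper₂ M
  ; Lt-proper₂   = Lt-proper₁ M
  ; Up-proper    = Down-proper M
  ; Down-proper  = Up-proper M
  ; Lt-sym₁      = Lt-sym₂ M
  ; Lt-sym₂      = Lt-sym₁ M
  ; Up-sym       = Down-sym M
  ; Down-sym     = Up-sym M
  ; Lt-irrefl    = Lt-irrefl M
  ; Lt-trans     = λ p q → Lt-trans M q p
  ; switch       = λ x≢y x≢z y≢z → switch M x≢z x≢y (y≢z ∘ sym)
  ; trichotomy   = λ a b≢c →
      [ [ inj₂ , inj₁ ∘ inj₂ ]′ , inj₁ ∘ inj₁ ]′ (trichotomy M a b≢c)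
  ; Up-notin₁    = Down-notin₁ M
  ; Up-notin₂    = Down-notin₂ M
  ; Down-notin₁  = Up-notin₁ M
  ; Down-notin₂  = Up-notin₂ M
  ; Up-Down-excl = λ d u → Up-Down-excl M u d
  ; upward       = downward M
  ; downward     = upward M
  }

module _ {B : LabeledSwitchboard A} {M : LabeledSwitchboard C} {p : D → A} {q : D → C} where

  dual-compatibleˡ : Compatible B (dual M) p q → Compatible (dual B) M p q
  dual-compatibleˡ c = record
    { eq   = Compatible.eq c
    ; lt   = λ i j k l → Compatible.lt c k l i j
    ; up   = Compatible.down c
    ; down = Compatible.up c
    }

  dual-compatibleʳ : Compatible (dual B) M p q → Compatible B (dual M) p q
  dual-compatibleʳ c = record
    { eq   = Compatible.eq c
    ; lt   = λ i j k l → Compatible.lt c k l i j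
    ; up   = Compatible.down c
    ; down = Compatible.up c
    }

dual-extension : {M : LabeledSwitchboard C} →
                 ExtensionProperty M → ExtensionProperty (dual M)
dual-extension ext n B g c with ext n (dual B) g (dual-compatibleˡ c)
... | m , emb = m , dual-compatibleʳ emb

induced : (M : LabeledSwitchboard C) (g : D → C) →
          Injective _≡_ _≡_ g → LabeledSwitchboard D
induced M g g-inj = record
  { Lt           = λ a b c d → Lt M (g a) (g b) (g c) (g d)
  ; Up           = λ a b c → Up M (g a) (g b) (g c)
  ; Down         = λ a b c → Down M (g a) (g b) (g c)
  ; Lt-proper₁   = λ h → Lt-proper₁ M h ∘ cong g
  ; Lt-proper₂   = λ h → Lt-proper₂ M h ∘ cong g
  ; Up-proper    = λ u → Up-proper M u ∘ cong g
  ; Down-proper  = λ d → Down-proper M d ∘ cong g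
  ; Lt-sym₁      = Lt-sym₁ M
  ; Lt-sym₂      = Lt-sym₂ M
  ; Up-sym       = Up-sym M
  ; Down-sym     = Down-sym M
  ; Lt-irrefl    = Lt-irrefl M
  ; Lt-trans     = Lt-trans M
  ; switch       = λ x≢y x≢z y≢z →
      switch M (x≢y ∘ g-inj) (x≢z ∘ g-inj) (y≢z ∘ g-inj)
  ; trichotomy   = λ a b≢c →
      map₁ (map₂ (map g-inj g-inj)) (trichotomy M (g a) (b≢c ∘ g-inj))
  ; Up-notin₁    = λ u → Up-notin₁ M u ∘ cong g
  ; Up-notin₂    = λ u → Up-notin₂ M u ∘ cong g
  ; Down-notin₁  = λ d → Down-notin₁ M d ∘ cong g
  ; Down-notin₂  = λ d → Down-notin₂ M d ∘ cong g
  ; Up-Down-excl = Up-Down-excl M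
  ; upward       = upward M
  ; downward     = downward M
  }

induced-compatible : (M : LabeledSwitchboard C) (g : D → C) (g-inj : Injective _≡_ _≡_ g) →
                     Compatible (induced M g g-inj) M id g
induced-compatible M g g-inj = record
  { eq   = λ i j → mk⇔ (cong g) g-inj
  ; lt   = λ i j k l → ⇔.refl
  ; up   = λ i j k → ⇔.refl
  ; down = λ i j k → ⇔.refl
  }

module AdjoinBelow {n : ℕ} (A : LabeledSwitchboard (Fin n)) (x : Fin n) where

  data Lt⁺ : Fin (suc n) → Fin (suc n) → Fin (suc n) → Fin (suc n) → Set where
    old  : ∀ {a b c d} → Lt A a b c d → Lt⁺ (suc a) (suc b) (suc c) (suc d)
    newˡ : ∀ {c d} → Up A x c d → Lt⁺ zero (suc x) (suc c) (suc d)
    newʳ : ∀ {c d} → Up A x c d → Lt⁺ (suc x) zero (suc c) (suc d)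

  data Up⁺ : Fin (suc n) → Fin (suc n) → Fin (suc n) → Set where
    old : ∀ {a b c} → Up A a b c → Up⁺ (suc a) (suc b) (suc c)
    new : ∀ {b c} → b ≢ c → Up⁺ zero (suc b) (suc c)

  data Down⁺ : Fin (suc n) → Fin (suc n) → Fin (suc n) → Set where
    old  : ∀ {a b c} → Down A a b c → Down⁺ (suc a) (suc b) (suc c)
    newˡ : ∀ {a c} → a ≢ c → Down⁺ (suc a) zero (suc c)
    newʳ : ∀ {a b} → a ≢ b → Down⁺ (suc a) (suc b) zero

  private
    suc-≢ : {a b : Fin n} → a ≢ b → suc a ≢ suc b
    suc-≢ a≢b = a≢b ∘ suc-injective

    Lt⁺-proper₁ : ∀ {a b c d} → Lt⁺ a b c d → a ≢ b
    Lt⁺-proper₁ (old h)  = suc-≢ (Lt-proper₁ A h)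
    Lt⁺-proper₁ (newˡ _) = λ ()
    Lt⁺-proper₁ (newʳ _) = λ ()

    Lt⁺-proper₂ : ∀ {a b c d} → Lt⁺ a b c d → c ≢ d
    Lt⁺-proper₂ (old h)  = suc-≢ (Lt-proper₂ A h)
    Lt⁺-proper₂ (newˡ u) = suc-≢ (Up-proper A u)
    Lt⁺-proper₂ (newʳ u) = suc-≢ (Up-proper A u)

    Lt⁺-sym₁ : ∀ {a b c d} → Lt⁺ a b c d → Lt⁺ b a c d
    Lt⁺-sym₁ (old h)  = old (Lt-sym₁ A h)
    Lt⁺-sym₁ (newˡ u) = newʳ u
    Lt⁺-sym₁ (newʳ u) = newˡ u

    Lt⁺-sym₂ : ∀ {a b c d} → Lt⁺ a b c d → Lt⁺ a b d c
    Lt⁺-sym₂ (old h)  = old (Lt-sym₂ A h)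
    Lt⁺-sym₂ (newˡ u) = newˡ (Up-sym A u)
    Lt⁺-sym₂ (newʳ u) = newʳ (Up-sym A u)

    Lt⁺-irrefl : ∀ {a b} → Lt⁺ a b a b → ⊥
    Lt⁺-irrefl (old h) = Lt-irrefl A h

    Lt⁺-trans : ∀ {a b c d e f} → Lt⁺ a b c d → Lt⁺ c d e f → Lt⁺ a b e f
    Lt⁺-trans (old h)  (old h′) = old (Lt-trans A h h′)
    Lt⁺-trans (newˡ u) (old h′) = newˡ (upward A u h′)
    Lt⁺-trans (newʳ u) (old h′) = newʳ (upward A u h′)

    switch⁺ : ∀ {a b c} → a ≢ b → a ≢ c → b ≢ c → Lt⁺ a b a c → ⊥
    switch⁺ a≢b a≢c b≢c (old h)  = switch A (a≢b ∘ cong suc) (a≢c ∘ cong suc) (b≢c ∘ cong suc) h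
    switch⁺ a≢b a≢c b≢c (newʳ u) = Up-notin₁ A u refl

    trichotomy⁺ : ∀ a {b c} → b ≢ c → (Up⁺ a b c ⊎ (a ≡ b ⊎ a ≡ c)) ⊎ Down⁺ a b c
    trichotomy⁺ zero    {zero}            _   = inj₁ (inj₂ (inj₁ refl))
    trichotomy⁺ zero    {suc _} {zero}    _   = inj₁ (inj₂ (inj₂ refl))
    trichotomy⁺ zero    {suc _} {suc _}   b≢c = inj₁ (inj₁ (new (b≢c ∘ cong suc)))
    trichotomy⁺ (suc a) {zero}  {zero}    b≢c = ⊥-elim (b≢c refl)
    trichotomy⁺ (suc a) {zero}  {suc c}   _ with a ≟ c
    ... | yes a≡c = inj₁ (inj₂ (inj₂ (cong suc a≡c)))
    ... | no  a≢c = inj₂ (newˡ a≢c)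
    trichotomy⁺ (suc a) {suc b} {zero}    _ with a ≟ b
    ... | yes a≡b = inj₁ (inj₂ (inj₁ (cong suc a≡b)))
    ... | no  a≢b = inj₂ (newʳ a≢b)
    trichotomy⁺ (suc a) {suc b} {suc c}   b≢c =
      map (map old (map (cong suc) (cong suc))) old (trichotomy A a (b≢c ∘ cong suc))

    Up⁺-proper : ∀ {a b c} → Up⁺ a b c → b ≢ c
    Up⁺-proper (old u)   = suc-≢ (Up-proper A u)
    Up⁺-proper (new b≢c) = suc-≢ b≢c

    Down⁺-proper : ∀ {a b c} → Down⁺ a b c → b ≢ c
    Down⁺-proper (old d)  = suc-≢ (Down-proper A d)
    Down⁺-proper (newˡ _) = λ ()
    Down⁺-proper (newʳ _) = λ ()

    Up⁺-sym : ∀ {a b c} → Up⁺ a b c → Up⁺ a c b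
    Up⁺-sym (old u)   = old (Up-sym A u)
    Up⁺-sym (new b≢c) = new (b≢c ∘ sym)

    Down⁺-sym : ∀ {a b c} → Down⁺ a b c → Down⁺ a c b
    Down⁺-sym (old d)    = old (Down-sym A d)
    Down⁺-sym (newˡ a≢c) = newʳ a≢c
    Down⁺-sym (newʳ a≢b) = newˡ a≢b

    Up⁺-notin₁ : ∀ {a b c} → Up⁺ a b c → a ≢ b
    Up⁺-notin₁ (old u) = suc-≢ (Up-notin₁ A u)
    Up⁺-notin₁ (new _) = λ ()

    Up⁺-notin₂ : ∀ {a b c} → Up⁺ a b c → a ≢ c
    Up⁺-notin₂ (old u) = suc-≢ (Up-notin₂ A u)
    Up⁺-notin₂ (new _) = λ ()

    Down⁺-notin₁ : ∀ {a b c} → Down⁺ a b c → a ≢ b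
    Down⁺-notin₁ (old d)    = suc-≢ (Down-notin₁ A d)
    Down⁺-notin₁ (newˡ _)   = λ ()
    Down⁺-notin₁ (newʳ a≢b) = suc-≢ a≢b

    Down⁺-notin₂ : ∀ {a b c} → Down⁺ a b c → a ≢ c
    Down⁺-notin₂ (old d)    = suc-≢ (Down-notin₂ A d)
    Down⁺-notin₂ (newˡ a≢c) = suc-≢ a≢c
    Down⁺-notin₂ (newʳ _)   = λ ()

    Up⁺-Down⁺-excl : ∀ {a b c} → Up⁺ a b c → Down⁺ a b c → ⊥
    Up⁺-Down⁺-excl (old u) (old d) = Up-Down-excl A u d

    upward⁺ : ∀ {a b c b′ c′} → Up⁺ a b c → Lt⁺ b c b′ c′ → Up⁺ a b′ c′
    upward⁺ (old u) (old h) = old (upward A u h)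
    upward⁺ (new _) (old h) = new (Lt-proper₂ A h)

    -- An old point below a pair that x is above cannot be x itself.
    downward⁺ : ∀ {a b c b′ c′} → Down⁺ a b c → Lt⁺ b′ c′ b c → Down⁺ a b′ c′
    downward⁺ (old d) (old h)  = old (downward A d h)
    downward⁺ (old d) (newˡ u) = newˡ λ { refl → Up-Down-excl A u d }
    downward⁺ (old d) (newʳ u) = newʳ λ { refl → Up-Down-excl A u d }

  adjoinBelow : LabeledSwitchboard (Fin (suc n))
  adjoinBelow = record
    { Lt           = Lt⁺
    ; Up           = Up⁺
    ; Down         = Down⁺
    ; Lt-proper₁   = Lt⁺-proper₁
    ; Lt-proper₂   = Lt⁺-proper₂
    ; Up-proper    = Up⁺-proper
    ; Down-proper  = Down⁺-proper
    ; Lt-sym₁      = Lt⁺-sym₁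
    ; Lt-sym₂      = Lt⁺-sym₂
    ; Up-sym       = Up⁺-sym
    ; Down-sym     = Down⁺-sym
    ; Lt-irrefl    = Lt⁺-irrefl
    ; Lt-trans     = Lt⁺-trans
    ; switch       = switch⁺
    ; trichotomy   = trichotomy⁺
    ; Up-notin₁    = Up⁺-notin₁
    ; Up-notin₂    = Up⁺-notin₂
    ; Down-notin₁  = Down⁺-notin₁
    ; Down-notin₂  = Down⁺-notin₂
    ; Up-Down-excl = Up⁺-Down⁺-excl
    ; upward       = upward⁺
    ; downward     = downward⁺
    }

  adjoinBelow-compatible : {M : LabeledSwitchboard C} {g : Fin n → C} →
                           Compatible A M id g → Compatible adjoinBelow M suc g
  adjoinBelow-compatible c = record
    { eq   = λ i j → ⇔.trans (mk⇔ suc-injective (cong suc)) (Compatible.eq c i j)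
    ; lt   = λ i j k l → ⇔.trans (mk⇔ (λ { (old h) → h }) old) (Compatible.lt c i j k l)
    ; up   = λ i j k → ⇔.trans (mk⇔ (λ { (old u) → u }) old) (Compatible.up c i j k)
    ; down = λ i j k → ⇔.trans (mk⇔ (λ { (old d) → d }) old) (Compatible.down c i j k)
    }

open AdjoinBelow using (adjoinBelow; adjoinBelow-compatible; newˡ)

triple : C → C → C → Fin 3 → C
triple x y z zero             = x
triple x y z (suc zero)       = y
triple x y z (suc (suc zero)) = z

triple-injective : {x y z : C} → x ≢ y → x ≢ z → y ≢ z → Injective _≡_ _≡_ (triple x y z)
triple-injective x≢y x≢z y≢z {zero}            {zero}            _ = refl
triple-injective x≢y x≢z y≢z {zero}            {suc zero}        e = ⊥-elim (x≢y e)
triple-injective x≢y x≢z y≢z {zero}            {suc (suc zero)}  e = ⊥-elim (x≢z e)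
triple-injective x≢y x≢z y≢z {suc zero}        {zero}            e = ⊥-elim (x≢y (sym e))
triple-injective x≢y x≢z y≢z {suc zero}        {suc zero}        _ = refl
triple-injective x≢y x≢z y≢z {suc zero}        {suc (suc zero)}  e = ⊥-elim (y≢z e)
triple-injective x≢y x≢z y≢z {suc (suc zero)}  {zero}            e = ⊥-elim (x≢z (sym e))
triple-injective x≢y x≢z y≢z {suc (suc zero)}  {suc zero}        e = ⊥-elim (y≢z (sym e))
triple-injective x≢y x≢z y≢z {suc (suc zero)}  {suc (suc zero)}  _ = refl

module _ {M : LabeledSwitchboard C} {x y z : C} where

  below-pair⇒Up : ∀ {w} → Lt M x w y z → x ≢ y → x ≢ z → Up M x y z
  below-pair⇒Up x∧w<y∧z x≢y x≢z with trichotomy M x (Lt-proper₂ M x∧w<y∧z)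
  ... | inj₁ (inj₁ x↑y∧z)        = x↑y∧z
  ... | inj₁ (inj₂ (inj₁ x≡y))   = ⊥-elim (x≢y x≡y)
  ... | inj₁ (inj₂ (inj₂ x≡z))   = ⊥-elim (x≢z x≡z)
  ... | inj₂ x↓y∧z               = ⊥-elim (Down-notin₁ M (downward M x↓y∧z x∧w<y∧z) refl)

  Up⇒below-pair : ExtensionProperty M → x ≢ y → x ≢ z → y ≢ z →
                  Up M x y z → Σ C (λ w → w ≢ x × Lt M x w y z)
  Up⇒below-pair ext x≢y x≢z y≢z x↑y∧z =
    realise (ext 3 wxyz (triple x y z) (adjoinBelow-compatible xyz zero (induced-compatible M _ _)))
    where
    xyz : LabeledSwitchboard (Fin 3)
    xyz = induced M (triple x y z) (triple-injective x≢y x≢z y≢z)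
    wxyz : LabeledSwitchboard (Fin 4)
    wxyz = adjoinBelow xyz zero
    realise : Σ C (λ w → IsEmbedding wxyz M (extend w (triple x y z))) →
              Σ C (λ w → w ≢ x × Lt M x w y z)
    realise (w , emb) = w , w≢x , Lt-sym₁ M w∧x<y∧z
      where
      w≢x : w ≢ x
      w≢x = 0≢1+n ∘ Equivalence.from (Compatible.eq emb zero (suc zero))
      w∧x<y∧z : Lt M w x y z
      w∧x<y∧z = Equivalence.to (Compatible.lt emb zero (suc zero) (suc (suc zero)) (suc (suc (suc zero))))
                               (newˡ x↑y∧z)

  Up⇔below-pair : ExtensionProperty M → x ≢ y → x ≢ z → y ≢ z →
                  Up M x y z ⇔ Σ C (λ w → w ≢ x × Lt M x w y z)
  Up⇔below-pair ext x≢y x≢z y≢z =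
    mk⇔ (Up⇒below-pair ext x≢y x≢z y≢z) (λ { (_ , _ , x∧w<y∧z) → below-pair⇒Up x∧w<y∧z x≢y x≢z })

lemma4p18 : {C : Set} (T : ModelOfTplus C) →
    let M = ModelOfTplus.structure T in
    ∀ (x y z : C) → x ≢ y → x ≢ z → y ≢ z →
      (Up M x y z ⇔ Σ C (λ w → w ≢ x × Lt M x w y z))
      × (Down M x y z ⇔ Σ C (λ w → w ≢ x × Lt M y z x w))
lemma4p18 T x y z x≢y x≢z y≢z =
  Up⇔below-pair ext x≢y x≢z y≢z , Up⇔below-pair (dual-extension ext) x≢y x≢z y≢z
  where
  ext : ExtensionProperty (ModelOfTplus.structure T)
  ext = ModelOfTplus.extension T
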